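{- Let $\Gamma$ be a context, $t$ a proof-term and $A$ a proposition of the $\odot$-calculus such that $\Gamma \vdash t : A$. Then $t$ strongly terminates, i.e. there is no infinite reduction sequence $t \longrightarrow t_1 \longrightarrow t_2 \longrightarrow \cdots$.
   Context: The $\odot$-calculus. Propositions: $A ::= \top \mid \bot \mid A \Rightarrow A \mid A \wedge A \mid A \vee A \mid A \odot A$. Proof-terms: $t ::= x \mid t \parallel u \mid * \mid \delta_\bot(t) \mid \lambda x\, t \mid t\,u \mid \langle t,u\rangle \mid \delta_\wedge(t,[x,y]u) \mid \mathrm{inl}(t) \mid \mathrm{inr}(t) \mid \delta_\vee(t,[x]u,[y]v) \mid t+u \mid \delta_\odot(t,[x]u,[y]v) \mid \delta_\odot^\parallel(t,[x]u,[y]v)$, where $\lambda x$ binds $x$, $[x,y]$ binds $x,y$, and $[x]$, $[y]$ bind $x$, $y$ respectively; $(u/x)t$ denotes capture-avoiding substitution. Contexts $\Gamma$ are finite lists $x_1:A_1,\dots,x_n:A_n$. Typing rules: $\Gamma\vdash x:A$ if $x:A\in\Gamma$; from $\Gamma\vdash t:A$ and $\Gamma\vdash u:A$ infer $\Gamma\vdash t\parallel u:A$; $\Gamma\vdash *:\top$; from $\Gamma\vdash t:\bot$ infer $\Gamma\vdash\delta_\bot(t):C$; from $\Gamma,x:A\vdash t:B$ infer $\Gamma\vdash\lambda x\,t:A\Rightarrow B$; from $\Gamma\vdash t:A\Rightarrow B$ and $\Gamma\vdash u:A$ infer $\Gamma\vdash t\,u:B$; from $\Gamma\vdash t:A$,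 $\Gamma\vdash u:B$ infer $\Gamma\vdash\langle t,u\rangle:A\wedge B$; from $\Gamma\vdash t:A\wedge B$ and $\Gamma,x:A,y:B\vdash u:C$ infer $\Gamma\vdash\delta_\wedge(t,[x,y]u):C$; from $\Gamma\vdash t:A$ infer $\Gamma\vdash\mathrm{inl}(t):A\vee B$; from $\Gamma\vdash t:B$ infer $\Gamma\vdash\mathrm{inr}(t):A\vee B$; from $\Gamma\vdash t:A\vee B$, $\Gamma,x:A\vdash u:C$, $\Gamma,y:B\vdash v:C$ infer $\Gamma\vdash\delta_\vee(t,[x]u,[y]v):C$; from $\Gamma\vdash t:A$, $\Gamma\vdash u:B$ infer $\Gamma\vdash t+u:A\odot B$; from $\Gamma\vdash t:A\odot B$, $\Gamma,x:A\vdash u:C$, $\Gamma,y:B\vdash v:C$ infer both $\Gamma\vdash\delta_\odot(t,[x]u,[y]v):C$ and $\Gamma\vdash\delta_\odot^\parallel(t,[x]u,[y]v):C$. Reduction rules: $(\lambda x\,t)\,u\to(u/x)t$; $\delta_\wedge(\langle t,u\rangle,[x,y]v)\to(t/x,u/y)v$; $\delta_\vee(\mathrm{inl}(t),[x]v,[y]w)\to(t/x)v$; $\delta_\vee(\mathrm{inr}(u),[x]v,[y]w)\to(u/y)w$; $\delta_\odot(t+u,[x]v,[y]w)\to(t/x)v$; $\delta_\odot(t+u,[x]v,[y]w)\to(u/y)w$; $\delta_\odot^\parallel(t+u,[x]v,[y]w)\to(t/x)v\parallel(u/y)w$; $(\lambda x\,t)\parallel(\lambda x\,u)\to\lambda x\,(t\parallel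 u)$; $\langle t,u\rangle\parallel\langle v,w\rangle\to\langle t\parallel v,u\parallel w\rangle$; $\delta_\vee(t\parallel u,[x]v,[y]w)\to\delta_\vee(t,[x]v,[y]w)\parallel\delta_\vee(u,[x]v,[y]w)$; $(t+u)\parallel(v+w)\to(t\parallel v)+(u\parallel w)$; $t\parallel t\to t$. The (non-deterministic) reduction relation $\longrightarrow$ is the smallest relation closed under all term constructors (contextual) containing $\sigma l\to\sigma r$ for every rule $l\to r$ and every substitution $\sigma$. -}

module Defs where

-- The ⊙-calculus, with proof-terms in de Bruijn notation (so α-equivalence
-- is syntactic equality and substitution is capture-avoiding by construction).

open import Data.Nat using (ℕ; zero; suc)
open import Data.List using (List; []; _∷_)
open import Data.Product using (Σ; _×_)
open import Relation.Binary.PropositionalEquality using (_≡_)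

infixr 7 _⇒_
infixr 8 _∧_ _∨_ _⊙_

data Form : Set where
  ⊤ ⊥    : Form
  _⇒_    : Form → Form → Form
  _∧_    : Form → Form → Form
  _∨_    : Form → Form → Form
  _⊙_    : Form → Form → Form

data Term : Set where
  var   : ℕ → Term
  _∥_   : Term → Term → Term
  star  : Term
  δ⊥    : Term → Term
  lam   : Term → Term                       -- λx t       : t under 1 binder
  app   : Term → Term → Term
  pair  : Term → Term → Term
  δ∧    : Term → Term → Term                -- δ∧(t,[x,y]u): u under 2 binders (x = 1, y = 0)
  inl   : Term → Term
  inr   : Term → Term
  δ∨    : Term → Term → Term → Term         -- δ∨(t,[x]u,[y]v): u, v under 1 binder
  _+_   : Term → Term → Term
  δ⊙    : Term → Term → Term → Term
  δ⊙∥   : Term → Term → Term → Term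

ext : (ℕ → ℕ) → ℕ → ℕ
ext ρ zero    = zero
ext ρ (suc n) = suc (ρ n)

rename : (ℕ → ℕ) → Term → Term
rename ρ (var n)       = var (ρ n)
rename ρ (t ∥ u)       = rename ρ t ∥ rename ρ u
rename ρ star          = star
rename ρ (δ⊥ t)        = δ⊥ (rename ρ t)
rename ρ (lam t)       = lam (rename (ext ρ) t)
rename ρ (app t u)     = app (rename ρ t) (rename ρ u)
rename ρ (pair t u)    = pair (rename ρ t) (rename ρ u)
rename ρ (δ∧ t u)      = δ∧ (rename ρ t) (rename (ext (ext ρ)) u)
rename ρ (inl t)       = inl (rename ρ t)
rename ρ (inr t)       = inr (rename ρ t)
rename ρ (δ∨ t u v)    = δ∨ (rename ρ t) (rename (ext ρ) u) (rename (ext ρ) v)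
rename ρ (t + u)       = rename ρ t + rename ρ u
rename ρ (δ⊙ t u v)    = δ⊙ (rename ρ t) (rename (ext ρ) u) (rename (ext ρ) v)
rename ρ (δ⊙∥ t u v)   = δ⊙∥ (rename ρ t) (rename (ext ρ) u) (rename (ext ρ) v)

exts : (ℕ → Term) → ℕ → Term
exts σ zero    = var zero
exts σ (suc n) = rename suc (σ n)

subst : (ℕ → Term) → Term → Term
subst σ (var n)       = σ n
subst σ (t ∥ u)       = subst σ t ∥ subst σ u
subst σ star          = star
subst σ (δ⊥ t)        = δ⊥ (subst σ t)
subst σ (lam t)       = lam (subst (exts σ) t)
subst σ (app t u)     = app (subst σ t) (subst σ u)
subst σ (pair t u)    = pair (subst σ t) (subst σ u)
subst σ (δ∧ t u)      = δ∧ (subst σ t) (subst (exts (exts σ)) u)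
subst σ (inl t)       = inl (subst σ t)
subst σ (inr t)       = inr (subst σ t)
subst σ (δ∨ t u v)    = δ∨ (subst σ t) (subst (exts σ) u) (subst (exts σ) v)
subst σ (t + u)       = subst σ t + subst σ u
subst σ (δ⊙ t u v)    = δ⊙ (subst σ t) (subst (exts σ) u) (subst (exts σ) v)
subst σ (δ⊙∥ t u v)   = δ⊙∥ (subst σ t) (subst (exts σ) u) (subst (exts σ) v)

-- (u/x)t where x is the outermost-bound variable 0
sub1 : Term → ℕ → Term
sub1 u zero    = u
sub1 u (suc n) = var n

_[_] : Term → Term → Term
t [ u ] = subst (sub1 u) t

-- (t/x, u/y)v where x = index 1, y = index 0
sub2 : Term → Term → ℕ → Term
sub2 t u zero          = u
sub2 t u (suc zero)    = t
sub2 t u (suc (suc n)) = var n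

_[_,_] : Term → Term → Term → Term
v [ t , u ] = subst (sub2 t u) v

-- Contexts: the head of the list is the most recently bound variable (index 0)
Ctx : Set
Ctx = List Form

data _∋_⦂_ : Ctx → ℕ → Form → Set where
  here  : ∀ {Γ A} → (A ∷ Γ) ∋ zero ⦂ A
  there : ∀ {Γ A B n} → Γ ∋ n ⦂ A → (B ∷ Γ) ∋ suc n ⦂ A

infix 4 _⊢_⦂_
data _⊢_⦂_ : Ctx → Term → Form → Set where
  ⊢var  : ∀ {Γ n A} → Γ ∋ n ⦂ A → Γ ⊢ var n ⦂ A
  ⊢par  : ∀ {Γ t u A} → Γ ⊢ t ⦂ A → Γ ⊢ u ⦂ A → Γ ⊢ t ∥ u ⦂ A
  ⊢star : ∀ {Γ} → Γ ⊢ star ⦂ ⊤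
  ⊢δ⊥   : ∀ {Γ t C} → Γ ⊢ t ⦂ ⊥ → Γ ⊢ δ⊥ t ⦂ C
  ⊢lam  : ∀ {Γ t A B} → (A ∷ Γ) ⊢ t ⦂ B → Γ ⊢ lam t ⦂ A ⇒ B
  ⊢app  : ∀ {Γ t u A B} → Γ ⊢ t ⦂ A ⇒ B → Γ ⊢ u ⦂ A → Γ ⊢ app t u ⦂ B
  ⊢pair : ∀ {Γ t u A B} → Γ ⊢ t ⦂ A → Γ ⊢ u ⦂ B → Γ ⊢ pair t u ⦂ A ∧ B
  ⊢δ∧   : ∀ {Γ t u A B C} → Γ ⊢ t ⦂ A ∧ B → (B ∷ A ∷ Γ) ⊢ u ⦂ C → Γ ⊢ δ∧ t u ⦂ C
  ⊢inl  : ∀ {Γ t A B} → Γ ⊢ t ⦂ A → Γ ⊢ inl t ⦂ A ∨ B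
  ⊢inr  : ∀ {Γ t A B} → Γ ⊢ t ⦂ B → Γ ⊢ inr t ⦂ A ∨ B
  ⊢δ∨   : ∀ {Γ t u v A B C} → Γ ⊢ t ⦂ A ∨ B → (A ∷ Γ) ⊢ u ⦂ C → (B ∷ Γ) ⊢ v ⦂ C
          → Γ ⊢ δ∨ t u v ⦂ C
  ⊢plus : ∀ {Γ t u A B} → Γ ⊢ t ⦂ A → Γ ⊢ u ⦂ B → Γ ⊢ t + u ⦂ A ⊙ B
  ⊢δ⊙   : ∀ {Γ t u v A B C} → Γ ⊢ t ⦂ A ⊙ B → (A ∷ Γ) ⊢ u ⦂ C → (B ∷ Γ) ⊢ v ⦂ C
          → Γ ⊢ δ⊙ t u v ⦂ C
  ⊢δ⊙∥  : ∀ {Γ t u v A B C} → Γ ⊢ t ⦂ A ⊙ B → (A ∷ Γ) ⊢ u ⦂ C → (B ∷ Γ) ⊢ v ⦂ C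
          → Γ ⊢ δ⊙∥ t u v ⦂ C

infix 4 _⟶_
data _⟶_ : Term → Term → Set where
  β⇒     : ∀ {t u} → app (lam t) u ⟶ t [ u ]
  β∧     : ∀ {t u v} → δ∧ (pair t u) v ⟶ v [ t , u ]
  β∨l    : ∀ {t v w} → δ∨ (inl t) v w ⟶ v [ t ]
  β∨r    : ∀ {u v w} → δ∨ (inr u) v w ⟶ w [ u ]
  β⊙l    : ∀ {t u v w} → δ⊙ (t + u) v w ⟶ v [ t ]
  β⊙r    : ∀ {t u v w} → δ⊙ (t + u) v w ⟶ w [ u ]
  β⊙∥    : ∀ {t u v w} → δ⊙∥ (t + u) v w ⟶ (v [ t ]) ∥ (w [ u ])
  ∥lam   : ∀ {t u} → lam t ∥ lam u ⟶ lam (t ∥ u)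
  ∥pair  : ∀ {t u v w} → pair t u ∥ pair v w ⟶ pair (t ∥ v) (u ∥ w)
  δ∨∥    : ∀ {t u v w} → δ∨ (t ∥ u) v w ⟶ δ∨ t v w ∥ δ∨ u v w
  ∥plus  : ∀ {t u v w} → (t + u) ∥ (v + w) ⟶ (t ∥ v) + (u ∥ w)
  ∥idem  : ∀ {t} → t ∥ t ⟶ t
  c∥₁    : ∀ {t t' u} → t ⟶ t' → t ∥ u ⟶ t' ∥ u
  c∥₂    : ∀ {t u u'} → u ⟶ u' → t ∥ u ⟶ t ∥ u'
  cδ⊥    : ∀ {t t'} → t ⟶ t' → δ⊥ t ⟶ δ⊥ t'
  clam   : ∀ {t t'} → t ⟶ t' → lam t ⟶ lam t'
  capp₁  : ∀ {t t' u} → t ⟶ t' → app t u ⟶ app t' u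
  capp₂  : ∀ {t u u'} → u ⟶ u' → app t u ⟶ app t u'
  cpair₁ : ∀ {t t' u} → t ⟶ t' → pair t u ⟶ pair t' u
  cpair₂ : ∀ {t u u'} → u ⟶ u' → pair t u ⟶ pair t u'
  cδ∧₁   : ∀ {t t' u} → t ⟶ t' → δ∧ t u ⟶ δ∧ t' u
  cδ∧₂   : ∀ {t u u'} → u ⟶ u' → δ∧ t u ⟶ δ∧ t u'
  cinl   : ∀ {t t'} → t ⟶ t' → inl t ⟶ inl t'
  cinr   : ∀ {t t'} → t ⟶ t' → inr t ⟶ inr t'
  cδ∨₁   : ∀ {t t' u v} → t ⟶ t' → δ∨ t u v ⟶ δ∨ t' u v
  cδ∨₂   : ∀ {t u u' v} → u ⟶ u' → δ∨ t u v ⟶ δ∨ t u' v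
  cδ∨₃   : ∀ {t u v v'} → v ⟶ v' → δ∨ t u v ⟶ δ∨ t u v'
  c+₁    : ∀ {t t' u} → t ⟶ t' → t + u ⟶ t' + u
  c+₂    : ∀ {t u u'} → u ⟶ u' → t + u ⟶ t + u'
  cδ⊙₁   : ∀ {t t' u v} → t ⟶ t' → δ⊙ t u v ⟶ δ⊙ t' u v
  cδ⊙₂   : ∀ {t u u' v} → u ⟶ u' → δ⊙ t u v ⟶ δ⊙ t u' v
  cδ⊙₃   : ∀ {t u v v'} → v ⟶ v' → δ⊙ t u v ⟶ δ⊙ t u v'
  cδ⊙∥₁  : ∀ {t t' u v} → t ⟶ t' → δ⊙∥ t u v ⟶ δ⊙∥ t' u v
  cδ⊙∥₂  : ∀ {t u u' v} → u ⟶ u' → δ⊙∥ t u v ⟶ δ⊙∥ t u' v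
  cδ⊙∥₃  : ∀ {t u v v'} → v ⟶ v' → δ⊙∥ t u v ⟶ δ⊙∥ t u v'

InfiniteReduction : Term → Set
InfiniteReduction t =
  Σ (ℕ → Term) λ f → (f zero ≡ t) × (∀ n → f n ⟶ f (suc n))

-- Reducibility in the style of Tait and Girard, on untyped terms. A term is
-- reducible at A when all its one-step reducts are, and it is either a variable
-- or an elimination, a parallel composition of terms reducible at A, or an
-- introduction of A whose components are reducible (for λ: maps reducible
-- arguments to reducible results). Reducible terms are strongly normalising,
-- and by induction on typing derivations every typed term is reducible.
-- The one new point is closure of reducibility under t ∥ u, shown by induction
-- on the strong normalisation of t and u: ∥idem returns t itself, and the
-- commutations ∥lam, ∥pair, ∥plus produce parallel compositions at the
-- component types, which are reducible by induction on the type.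

module Submission where

open import Defs
open import Data.Nat using (ℕ; zero; suc)
open import Data.List using (_∷_)
open import Data.Product using (_×_; _,_; ∃-syntax)
open import Data.Unit using (tt) renaming (⊤ to Unit)
open import Data.Empty using () renaming (⊥ to Empty)
open import Function using (_∘_; id; flip)
open import Induction.WellFounded using (Acc; acc)
open import Induction.InfiniteDescent using (descent∧acc⇒unsatisfiable)
open import Relation.Nullary using (¬_)
open import Relation.Binary.PropositionalEquality
  using (_≡_; _≗_; refl; sym; trans; cong; cong₂) renaming (subst to transport)

variable
  Γ : Ctx
  A B C : Form
  t t' u u' v w s a b c d : Term
  ρ ρ' ρ'' : ℕ → ℕ
  σ σ' τ : ℕ → Term

cong₃ : ∀ {X Y Z W : Set} (f : X → Y → Z → W) {x x' y y' z z'} →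
        x ≡ x' → y ≡ y' → z ≡ z' → f x y z ≡ f x' y' z'
cong₃ f refl refl refl = refl

ext-∘ : ρ ∘ ρ' ≗ ρ'' → ext ρ ∘ ext ρ' ≗ ext ρ''
ext-∘ e zero    = refl
ext-∘ e (suc n) = cong suc (e n)

rename-rename : ρ ∘ ρ' ≗ ρ'' → rename ρ ∘ rename ρ' ≗ rename ρ''
rename-rename e (var n)     = cong var (e n)
rename-rename e (t ∥ u)     = cong₂ _∥_ (rename-rename e t) (rename-rename e u)
rename-rename e star        = refl
rename-rename e (δ⊥ t)      = cong δ⊥ (rename-rename e t)
rename-rename e (lam t)     = cong lam (rename-rename (ext-∘ e) t)
rename-rename e (app t u)   = cong₂ app (rename-rename e t) (rename-rename e u)
rename-rename e (pair t u)  = cong₂ pair (rename-rename e t) (rename-rename e u)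
rename-rename e (δ∧ t u)    = cong₂ δ∧ (rename-rename e t) (rename-rename (ext-∘ (ext-∘ e)) u)
rename-rename e (inl t)     = cong inl (rename-rename e t)
rename-rename e (inr t)     = cong inr (rename-rename e t)
rename-rename e (δ∨ t u v)  = cong₃ δ∨ (rename-rename e t) (rename-rename (ext-∘ e) u) (rename-rename (ext-∘ e) v)
rename-rename e (t + u)     = cong₂ _+_ (rename-rename e t) (rename-rename e u)
rename-rename e (δ⊙ t u v)  = cong₃ δ⊙ (rename-rename e t) (rename-rename (ext-∘ e) u) (rename-rename (ext-∘ e) v)
rename-rename e (δ⊙∥ t u v) = cong₃ δ⊙∥ (rename-rename e t) (rename-rename (ext-∘ e) u) (rename-rename (ext-∘ e) v)

exts-ext : τ ∘ ρ ≗ σ → exts τ ∘ ext ρ ≗ exts σ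
exts-ext e zero    = refl
exts-ext e (suc n) = cong (rename suc) (e n)

subst-rename : τ ∘ ρ ≗ σ → subst τ ∘ rename ρ ≗ subst σ
subst-rename e (var n)     = e n
subst-rename e (t ∥ u)     = cong₂ _∥_ (subst-rename e t) (subst-rename e u)
subst-rename e star        = refl
subst-rename e (δ⊥ t)      = cong δ⊥ (subst-rename e t)
subst-rename e (lam t)     = cong lam (subst-rename (exts-ext e) t)
subst-rename e (app t u)   = cong₂ app (subst-rename e t) (subst-rename e u)
subst-rename e (pair t u)  = cong₂ pair (subst-rename e t) (subst-rename e u)
subst-rename e (δ∧ t u)    = cong₂ δ∧ (subst-rename e t) (subst-rename (exts-ext (exts-ext e)) u)
subst-rename e (inl t)     = cong inl (subst-rename e t)
subst-rename e (inr t)     = cong inr (subst-rename e t)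
subst-rename e (δ∨ t u v)  = cong₃ δ∨ (subst-rename e t) (subst-rename (exts-ext e) u) (subst-rename (exts-ext e) v)
subst-rename e (t + u)     = cong₂ _+_ (subst-rename e t) (subst-rename e u)
subst-rename e (δ⊙ t u v)  = cong₃ δ⊙ (subst-rename e t) (subst-rename (exts-ext e) u) (subst-rename (exts-ext e) v)
subst-rename e (δ⊙∥ t u v) = cong₃ δ⊙∥ (subst-rename e t) (subst-rename (exts-ext e) u) (subst-rename (exts-ext e) v)

rename-ext-suc : ∀ t → rename (ext ρ) (rename suc t) ≡ rename suc (rename ρ t)
rename-ext-suc t = trans (rename-rename (λ _ → refl) t) (sym (rename-rename (λ _ → refl) t))

ext-exts : rename ρ ∘ σ ≗ σ' → rename (ext ρ) ∘ exts σ ≗ exts σ'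
ext-exts e zero = refl
ext-exts {σ = σ} e (suc n) = trans (rename-ext-suc (σ n)) (cong (rename suc) (e n))

rename-subst : rename ρ ∘ σ ≗ σ' → rename ρ ∘ subst σ ≗ subst σ'
rename-subst e (var n)     = e n
rename-subst e (t ∥ u)     = cong₂ _∥_ (rename-subst e t) (rename-subst e u)
rename-subst e star        = refl
rename-subst e (δ⊥ t)      = cong δ⊥ (rename-subst e t)
rename-subst e (lam t)     = cong lam (rename-subst (ext-exts e) t)
rename-subst e (app t u)   = cong₂ app (rename-subst e t) (rename-subst e u)
rename-subst e (pair t u)  = cong₂ pair (rename-subst e t) (rename-subst e u)
rename-subst e (δ∧ t u)    = cong₂ δ∧ (rename-subst e t) (rename-subst (ext-exts (ext-exts e)) u)
rename-subst e (inl t)     = cong inl (rename-subst e t)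
rename-subst e (inr t)     = cong inr (rename-subst e t)
rename-subst e (δ∨ t u v)  = cong₃ δ∨ (rename-subst e t) (rename-subst (ext-exts e) u) (rename-subst (ext-exts e) v)
rename-subst e (t + u)     = cong₂ _+_ (rename-subst e t) (rename-subst e u)
rename-subst e (δ⊙ t u v)  = cong₃ δ⊙ (rename-subst e t) (rename-subst (ext-exts e) u) (rename-subst (ext-exts e) v)
rename-subst e (δ⊙∥ t u v) = cong₃ δ⊙∥ (rename-subst e t) (rename-subst (ext-exts e) u) (rename-subst (ext-exts e) v)

subst-exts-suc : ∀ t → subst (exts τ) (rename suc t) ≡ rename suc (subst τ t)
subst-exts-suc t = trans (subst-rename (λ _ → refl) t) (sym (rename-subst (λ _ → refl) t))

exts-exts : subst τ ∘ σ ≗ σ' → subst (exts τ) ∘ exts σ ≗ exts σ'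
exts-exts e zero = refl
exts-exts {σ = σ} e (suc n) = trans (subst-exts-suc (σ n)) (cong (rename suc) (e n))

subst-subst : subst τ ∘ σ ≗ σ' → subst τ ∘ subst σ ≗ subst σ'
subst-subst e (var n)     = e n
subst-subst e (t ∥ u)     = cong₂ _∥_ (subst-subst e t) (subst-subst e u)
subst-subst e star        = refl
subst-subst e (δ⊥ t)      = cong δ⊥ (subst-subst e t)
subst-subst e (lam t)     = cong lam (subst-subst (exts-exts e) t)
subst-subst e (app t u)   = cong₂ app (subst-subst e t) (subst-subst e u)
subst-subst e (pair t u)  = cong₂ pair (subst-subst e t) (subst-subst e u)
subst-subst e (δ∧ t u)    = cong₂ δ∧ (subst-subst e t) (subst-subst (exts-exts (exts-exts e)) u)
subst-subst e (inl t)     = cong inl (subst-subst e t)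
subst-subst e (inr t)     = cong inr (subst-subst e t)
subst-subst e (δ∨ t u v)  = cong₃ δ∨ (subst-subst e t) (subst-subst (exts-exts e) u) (subst-subst (exts-exts e) v)
subst-subst e (t + u)     = cong₂ _+_ (subst-subst e t) (subst-subst e u)
subst-subst e (δ⊙ t u v)  = cong₃ δ⊙ (subst-subst e t) (subst-subst (exts-exts e) u) (subst-subst (exts-exts e) v)
subst-subst e (δ⊙∥ t u v) = cong₃ δ⊙∥ (subst-subst e t) (subst-subst (exts-exts e) u) (subst-subst (exts-exts e) v)

exts-var : σ ≗ var → exts σ ≗ var
exts-var e zero    = refl
exts-var e (suc n) = cong (rename suc) (e n)

subst-var : σ ≗ var → subst σ ≗ id
subst-var e (var n)     = e n
subst-var e (t ∥ u)     = cong₂ _∥_ (subst-var e t) (subst-var e u)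
subst-var e star        = refl
subst-var e (δ⊥ t)      = cong δ⊥ (subst-var e t)
subst-var e (lam t)     = cong lam (subst-var (exts-var e) t)
subst-var e (app t u)   = cong₂ app (subst-var e t) (subst-var e u)
subst-var e (pair t u)  = cong₂ pair (subst-var e t) (subst-var e u)
subst-var e (δ∧ t u)    = cong₂ δ∧ (subst-var e t) (subst-var (exts-var (exts-var e)) u)
subst-var e (inl t)     = cong inl (subst-var e t)
subst-var e (inr t)     = cong inr (subst-var e t)
subst-var e (δ∨ t u v)  = cong₃ δ∨ (subst-var e t) (subst-var (exts-var e) u) (subst-var (exts-var e) v)
subst-var e (t + u)     = cong₂ _+_ (subst-var e t) (subst-var e u)
subst-var e (δ⊙ t u v)  = cong₃ δ⊙ (subst-var e t) (subst-var (exts-var e) u) (subst-var (exts-var e) v)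
subst-var e (δ⊙∥ t u v) = cong₃ δ⊙∥ (subst-var e t) (subst-var (exts-var e) u) (subst-var (exts-var e) v)

infixr 5 _•_

_•_ : Term → (ℕ → Term) → ℕ → Term
(u • σ) zero    = u
(u • σ) (suc n) = σ n

subst-rename-cancel : τ ∘ ρ ≗ var → ∀ t → subst τ (rename ρ t) ≡ t
subst-rename-cancel e t = trans (subst-rename e t) (subst-var (λ _ → refl) t)

[]-exts : ∀ σ u t → subst (exts σ) t [ u ] ≡ subst (u • σ) t
[]-exts σ u = subst-subst shift-back
  where
  shift-back : subst (sub1 u) ∘ exts σ ≗ u • σ
  shift-back zero    = refl
  shift-back (suc n) = subst-rename-cancel (λ _ → refl) (σ n)

[,]-exts : ∀ σ a b t → _[_,_] (subst (exts (exts σ)) t) a b ≡ subst (b • a • σ) t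
[,]-exts σ a b = subst-subst shift-back
  where
  shift-back : subst (sub2 a b) ∘ exts (exts σ) ≗ b • a • σ
  shift-back zero          = refl
  shift-back (suc zero)    = refl
  shift-back (suc (suc n)) =
    trans (subst-rename {σ = sub2 a b ∘ suc} (λ _ → refl) (rename suc (σ n)))
          (subst-rename-cancel (λ _ → refl) (σ n))

subst-[] : ∀ σ t u → subst σ (t [ u ]) ≡ subst (exts σ) t [ subst σ u ]
subst-[] σ t u = trans (subst-subst sub1-then-σ t) (sym ([]-exts σ (subst σ u) t))
  where
  sub1-then-σ : subst σ ∘ sub1 u ≗ subst σ u • σ
  sub1-then-σ zero    = refl
  sub1-then-σ (suc n) = refl

subst-[,] : ∀ σ v a b →
            subst σ (_[_,_] v a b) ≡ _[_,_] (subst (exts (exts σ)) v) (subst σ a) (subst σ b)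
subst-[,] σ v a b = trans (subst-subst sub2-then-σ v) (sym ([,]-exts σ (subst σ a) (subst σ b) v))
  where
  sub2-then-σ : subst σ ∘ sub2 a b ≗ subst σ b • subst σ a • σ
  sub2-then-σ zero          = refl
  sub2-then-σ (suc zero)    = refl
  sub2-then-σ (suc (suc n)) = refl

⟶-respʳ-≡ : u ≡ u' → t ⟶ u → t ⟶ u'
⟶-respʳ-≡ refl r = r

⟶-subst : ∀ σ → t ⟶ t' → subst σ t ⟶ subst σ t'
⟶-subst σ (β⇒ {t} {u})         = ⟶-respʳ-≡ (sym (subst-[] σ t u)) β⇒
⟶-subst σ (β∧ {t} {u} {v})     = ⟶-respʳ-≡ (sym (subst-[,] σ v t u)) β∧
⟶-subst σ (β∨l {t} {v})        = ⟶-respʳ-≡ (sym (subst-[] σ v t)) β∨l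
⟶-subst σ (β∨r {u} {w = w})    = ⟶-respʳ-≡ (sym (subst-[] σ w u)) β∨r
⟶-subst σ (β⊙l {t} {v = v})    = ⟶-respʳ-≡ (sym (subst-[] σ v t)) β⊙l
⟶-subst σ (β⊙r {u = u} {w = w}) = ⟶-respʳ-≡ (sym (subst-[] σ w u)) β⊙r
⟶-subst σ (β⊙∥ {t} {u} {v} {w}) =
  ⟶-respʳ-≡ (sym (cong₂ _∥_ (subst-[] σ v t) (subst-[] σ w u))) β⊙∥
⟶-subst σ ∥lam       = ∥lam
⟶-subst σ ∥pair      = ∥pair
⟶-subst σ δ∨∥        = δ∨∥
⟶-subst σ ∥plus      = ∥plus
⟶-subst σ ∥idem      = ∥idem
⟶-subst σ (c∥₁ r)    = c∥₁ (⟶-subst σ r)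
⟶-subst σ (c∥₂ r)    = c∥₂ (⟶-subst σ r)
⟶-subst σ (cδ⊥ r)    = cδ⊥ (⟶-subst σ r)
⟶-subst σ (clam r)   = clam (⟶-subst (exts σ) r)
⟶-subst σ (capp₁ r)  = capp₁ (⟶-subst σ r)
⟶-subst σ (capp₂ r)  = capp₂ (⟶-subst σ r)
⟶-subst σ (cpair₁ r) = cpair₁ (⟶-subst σ r)
⟶-subst σ (cpair₂ r) = cpair₂ (⟶-subst σ r)
⟶-subst σ (cδ∧₁ r)   = cδ∧₁ (⟶-subst σ r)
⟶-subst σ (cδ∧₂ r)   = cδ∧₂ (⟶-subst (exts (exts σ)) r)
⟶-subst σ (cinl r)   = cinl (⟶-subst σ r)
⟶-subst σ (cinr r)   = cinr (⟶-subst σ r)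
⟶-subst σ (cδ∨₁ r)   = cδ∨₁ (⟶-subst σ r)
⟶-subst σ (cδ∨₂ r)   = cδ∨₂ (⟶-subst (exts σ) r)
⟶-subst σ (cδ∨₃ r)   = cδ∨₃ (⟶-subst (exts σ) r)
⟶-subst σ (c+₁ r)    = c+₁ (⟶-subst σ r)
⟶-subst σ (c+₂ r)    = c+₂ (⟶-subst σ r)
⟶-subst σ (cδ⊙₁ r)   = cδ⊙₁ (⟶-subst σ r)
⟶-subst σ (cδ⊙₂ r)   = cδ⊙₂ (⟶-subst (exts σ) r)
⟶-subst σ (cδ⊙₃ r)   = cδ⊙₃ (⟶-subst (exts σ) r)
⟶-subst σ (cδ⊙∥₁ r)  = cδ⊙∥₁ (⟶-subst σ r)
⟶-subst σ (cδ⊙∥₂ r)  = cδ⊙∥₂ (⟶-subst (exts σ) r)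
⟶-subst σ (cδ⊙∥₃ r)  = cδ⊙∥₃ (⟶-subst (exts σ) r)

SN : Term → Set
SN = Acc (flip _⟶_)

SN-subst⁻¹ : ∀ σ → SN (subst σ t) → SN t
SN-subst⁻¹ σ (acc rs) = acc λ r → SN-subst⁻¹ σ (rs (⟶-subst σ r))

SN⇒¬InfiniteReduction : SN t → ¬ InfiniteReduction t
SN⇒¬InfiniteReduction = descent∧acc⇒unsatisfiable continue
  where
  continue : ∀ {t} → InfiniteReduction t → ∃[ t' ] t ⟶ t' × InfiniteReduction t'
  continue (f , refl , r) = f 1 , r 0 , (f ∘ suc , refl , r ∘ suc)

data Hereditary (P : Term → Set) : Term → Set where
  hered  : P t → (∀ {t'} → t ⟶ t' → Hereditary P t') → Hereditary P t
  hered∥ : Hereditary P t → Hereditary P u → (∀ {t'} → t ∥ u ⟶ t' → Hereditary P t') →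
           Hereditary P (t ∥ u)

Hereditary-⟶ : ∀ {P} → Hereditary P t → t ⟶ t' → Hereditary P t'
Hereditary-⟶ (hered _ rs) r    = rs r
Hereditary-⟶ (hered∥ _ _ rs) r = rs r

Hereditary⇒SN : ∀ {P} → Hereditary P t → SN t
Hereditary⇒SN (hered _ rs)    = acc λ r → Hereditary⇒SN (rs r)
Hereditary⇒SN (hered∥ _ _ rs) = acc λ r → Hereditary⇒SN (rs r)

-- Introductions of other types are never reducible, so the commutations ∥lam,
-- ∥pair and ∥plus only have to be handled at the type they commute (see ∥-Red).
Red : Form → Term → Set
RedHead : Form → Term → Set
RedBody : Form → Form → Term → Set

Red A = Hereditary (RedHead A)

RedBody A C u = ∀ a → Red A a → Red C (u [ a ])

RedHead _ (_ ∥ _)          = Empty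
RedHead (A ⇒ B) (lam s)    = RedBody A B s
RedHead _ (lam _)          = Empty
RedHead ⊤ star             = Unit
RedHead _ star             = Empty
RedHead (A ∧ B) (pair x y) = Red A x × Red B y
RedHead _ (pair _ _)       = Empty
RedHead (A ∨ B) (inl x)    = Red A x
RedHead _ (inl _)          = Empty
RedHead (A ∨ B) (inr y)    = Red B y
RedHead _ (inr _)          = Empty
RedHead (A ⊙ B) (x + y)    = Red A x × Red B y
RedHead _ (_ + _)          = Empty
RedHead _ _                = Unit

var-Red : ∀ A n → Red A (var n)
var-Red A n = hered tt λ ()

RedBody₂ : Form → Form → Form → Term → Set
RedBody₂ A B C u = ∀ a b → Red A a → Red B b → Red C (_[_,_] u a b)

RedBody-⟶ : RedBody A C u → u ⟶ u' → RedBody A C u'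
RedBody-⟶ h r a ra = Hereditary-⟶ (h a ra) (⟶-subst (sub1 a) r)

RedBody₂-⟶ : RedBody₂ A B C u → u ⟶ u' → RedBody₂ A B C u'
RedBody₂-⟶ h r a b ra rb = Hereditary-⟶ (h a b ra rb) (⟶-subst (sub2 a b) r)

RedBody⇒SN : RedBody A C u → SN u
RedBody⇒SN {A} h = SN-subst⁻¹ (sub1 (var 0)) (Hereditary⇒SN (h (var 0) (var-Red A 0)))

RedBody₂⇒SN : RedBody₂ A B C u → SN u
RedBody₂⇒SN {A} {B} h =
  SN-subst⁻¹ (sub2 (var 1) (var 0)) (Hereditary⇒SN (h (var 1) (var 0) (var-Red A 1) (var-Red B 0)))

star-Red : Red ⊤ star
star-Red = hered tt λ ()

lam-Red : RedBody A B s → Red (A ⇒ B) (lam s)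
lam-Red h = go (RedBody⇒SN h) h
  where
  go : SN s → RedBody A B s → Red (A ⇒ B) (lam s)
  go (acc rs) h = hered h λ { (clam r) → go (rs r) (RedBody-⟶ h r) }

pair-Red : Red A t → Red B u → Red (A ∧ B) (pair t u)
pair-Red rt ru = go (Hereditary⇒SN rt) (Hereditary⇒SN ru) rt ru
  where
  go : SN t → SN u → Red A t → Red B u → Red (A ∧ B) (pair t u)
  go (acc rs) (acc rs') rt ru = hered (rt , ru) λ
    { (cpair₁ r) → go (rs r) (acc rs') (Hereditary-⟶ rt r) ru
    ; (cpair₂ r) → go (acc rs) (rs' r) rt (Hereditary-⟶ ru r) }

plus-Red : Red A t → Red B u → Red (A ⊙ B) (t + u)
plus-Red rt ru = go (Hereditary⇒SN rt) (Hereditary⇒SN ru) rt ru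
  where
  go : SN t → SN u → Red A t → Red B u → Red (A ⊙ B) (t + u)
  go (acc rs) (acc rs') rt ru = hered (rt , ru) λ
    { (c+₁ r) → go (rs r) (acc rs') (Hereditary-⟶ rt r) ru
    ; (c+₂ r) → go (acc rs) (rs' r) rt (Hereditary-⟶ ru r) }

inl-Red : Red A t → Red (A ∨ B) (inl t)
inl-Red rt = go (Hereditary⇒SN rt) rt
  where
  go : SN t → Red A t → Red (A ∨ B) (inl t)
  go (acc rs) rt = hered rt λ { (cinl r) → go (rs r) (Hereditary-⟶ rt r) }

inr-Red : Red B t → Red (A ∨ B) (inr t)
inr-Red rt = go (Hereditary⇒SN rt) rt
  where
  go : SN t → Red B t → Red (A ∨ B) (inr t)
  go (acc rs) rt = hered rt λ { (cinr r) → go (rs r) (Hereditary-⟶ rt r) }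

∥-Red : ∀ A → Red A t → Red A u → Red A (t ∥ u)
∥-lam : ∀ A → RedHead A (lam a) → RedHead A (lam b) → Red A (lam (a ∥ b))
∥-pair : ∀ A → RedHead A (pair a b) → RedHead A (pair c d) → Red A (pair (a ∥ c) (b ∥ d))
∥-plus : ∀ A → RedHead A (a + b) → RedHead A (c + d) → Red A ((a ∥ c) + (b ∥ d))

∥-Red A rt ru = go (Hereditary⇒SN rt) (Hereditary⇒SN ru) rt ru
  where
  go : SN t → SN u → Red A t → Red A u → Red A (t ∥ u)
  go-⟶ : SN t → SN u → Red A t → Red A u → t ∥ u ⟶ w → Red A w
  go st su rt ru = hered∥ rt ru (go-⟶ st su rt ru)
  go-⟶ (acc rs) su rt ru (c∥₁ r)          = go (rs r) su (Hereditary-⟶ rt r) ru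
  go-⟶ st (acc rs) rt ru (c∥₂ r)          = go st (rs r) rt (Hereditary-⟶ ru r)
  go-⟶ _ _ rt _ ∥idem                     = rt
  go-⟶ _ _ (hered ha _) (hered hb _) ∥lam  = ∥-lam A ha hb
  go-⟶ _ _ (hered ha _) (hered hb _) ∥pair = ∥-pair A ha hb
  go-⟶ _ _ (hered ha _) (hered hb _) ∥plus = ∥-plus A ha hb

∥-lam (A ⇒ B) ha hb = lam-Red λ v rv → ∥-Red B (ha v rv) (hb v rv)
∥-pair (A ∧ B) (ra , rb) (rc , rd) = pair-Red (∥-Red A ra rc) (∥-Red B rb rd)
∥-plus (A ⊙ B) (ra , rb) (rc , rd) = plus-Red (∥-Red A ra rc) (∥-Red B rb rd)

δ⊥-Red : SN t → Red C (δ⊥ t)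
δ⊥-Red (acc rs) = hered tt λ { (cδ⊥ r) → δ⊥-Red (rs r) }

app-Red : Red (A ⇒ B) t → Red A u → Red B (app t u)
app-Red rt ru = go (Hereditary⇒SN rt) (Hereditary⇒SN ru) rt ru
  where
  go : SN t → SN u → Red (A ⇒ B) t → Red A u → Red B (app t u)
  go-⟶ : SN t → SN u → Red (A ⇒ B) t → Red A u → app t u ⟶ w → Red B w
  go st su rt ru = hered tt (go-⟶ st su rt ru)
  go-⟶ _ _ (hered h _) ru β⇒      = h _ ru
  go-⟶ (acc rs) su rt ru (capp₁ r) = go (rs r) su (Hereditary-⟶ rt r) ru
  go-⟶ st (acc rs) rt ru (capp₂ r) = go st (rs r) rt (Hereditary-⟶ ru r)

δ∧-Red : Red (A ∧ B) t → RedBody₂ A B C u → Red C (δ∧ t u)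
δ∧-Red rt h = go (Hereditary⇒SN rt) (RedBody₂⇒SN h) rt h
  where
  go : SN t → SN u → Red (A ∧ B) t → RedBody₂ A B C u → Red C (δ∧ t u)
  go-⟶ : SN t → SN u → Red (A ∧ B) t → RedBody₂ A B C u → δ∧ t u ⟶ w → Red C w
  go st su rt h = hered tt (go-⟶ st su rt h)
  go-⟶ _ _ (hered (ra , rb) _) h β∧ = h _ _ ra rb
  go-⟶ (acc rs) su rt h (cδ∧₁ r)   = go (rs r) su (Hereditary-⟶ rt r) h
  go-⟶ st (acc rs) rt h (cδ∧₂ r)   = go st (rs r) rt (RedBody₂-⟶ h r)

δ∨-Red : Red (A ∨ B) t → RedBody A C u → RedBody B C v → Red C (δ∨ t u v)
δ∨-Red rt hu hv = go rt (RedBody⇒SN hu) (RedBody⇒SN hv) hu hv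
  where
  -- Recursion on the reducibility of t rather than on SN t: δ∨∥ continues
  -- with the components of a parallel composition.
  go : Red (A ∨ B) t → SN u → SN v → RedBody A C u → RedBody B C v → Red C (δ∨ t u v)
  go-⟶ : Red (A ∨ B) t → SN u → SN v → RedBody A C u → RedBody B C v →
         δ∨ t u v ⟶ w → Red C w
  go rt su sv hu hv = hered tt (go-⟶ rt su sv hu hv)
  go-⟶ (hered ra _) _ _ hu _ β∨l            = hu _ ra
  go-⟶ (hered rb _) _ _ _ hv β∨r            = hv _ rb
  go-⟶ {C = C} (hered∥ rt₁ rt₂ _) su sv hu hv δ∨∥ =
    ∥-Red C (go rt₁ su sv hu hv) (go rt₂ su sv hu hv)
  go-⟶ (hered _ rs) su sv hu hv (cδ∨₁ r)    = go (rs r) su sv hu hv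
  go-⟶ (hered∥ _ _ rs) su sv hu hv (cδ∨₁ r) = go (rs r) su sv hu hv
  go-⟶ rt (acc rs) sv hu hv (cδ∨₂ r)        = go rt (rs r) sv (RedBody-⟶ hu r) hv
  go-⟶ rt su (acc rs) hu hv (cδ∨₃ r)        = go rt su (rs r) hu (RedBody-⟶ hv r)

δ⊙-Red : Red (A ⊙ B) t → RedBody A C u → RedBody B C v → Red C (δ⊙ t u v)
δ⊙-Red rt hu hv = go (Hereditary⇒SN rt) (RedBody⇒SN hu) (RedBody⇒SN hv) rt hu hv
  where
  go : SN t → SN u → SN v → Red (A ⊙ B) t → RedBody A C u → RedBody B C v → Red C (δ⊙ t u v)
  go-⟶ : SN t → SN u → SN v → Red (A ⊙ B) t → RedBody A C u → RedBody B C v →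
         δ⊙ t u v ⟶ w → Red C w
  go st su sv rt hu hv = hered tt (go-⟶ st su sv rt hu hv)
  go-⟶ _ _ _ (hered (ra , _) _) hu _ β⊙l = hu _ ra
  go-⟶ _ _ _ (hered (_ , rb) _) _ hv β⊙r = hv _ rb
  go-⟶ (acc rs) su sv rt hu hv (cδ⊙₁ r) = go (rs r) su sv (Hereditary-⟶ rt r) hu hv
  go-⟶ st (acc rs) sv rt hu hv (cδ⊙₂ r) = go st (rs r) sv rt (RedBody-⟶ hu r) hv
  go-⟶ st su (acc rs) rt hu hv (cδ⊙₃ r) = go st su (rs r) rt hu (RedBody-⟶ hv r)

δ⊙∥-Red : Red (A ⊙ B) t → RedBody A C u → RedBody B C v → Red C (δ⊙∥ t u v)
δ⊙∥-Red rt hu hv = go (Hereditary⇒SN rt) (RedBody⇒SN hu) (RedBody⇒SN hv) rt hu hv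
  where
  go : SN t → SN u → SN v → Red (A ⊙ B) t → RedBody A C u → RedBody B C v → Red C (δ⊙∥ t u v)
  go-⟶ : SN t → SN u → SN v → Red (A ⊙ B) t → RedBody A C u → RedBody B C v →
         δ⊙∥ t u v ⟶ w → Red C w
  go st su sv rt hu hv = hered tt (go-⟶ st su sv rt hu hv)
  go-⟶ {C = C} _ _ _ (hered (ra , rb) _) hu hv β⊙∥ = ∥-Red C (hu _ ra) (hv _ rb)
  go-⟶ (acc rs) su sv rt hu hv (cδ⊙∥₁ r) = go (rs r) su sv (Hereditary-⟶ rt r) hu hv
  go-⟶ st (acc rs) sv rt hu hv (cδ⊙∥₂ r) = go st (rs r) sv rt (RedBody-⟶ hu r) hv
  go-⟶ st su (acc rs) rt hu hv (cδ⊙∥₃ r) = go st su (rs r) rt hu (RedBody-⟶ hv r)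

RedSubst : Ctx → (ℕ → Term) → Set
RedSubst Γ σ = ∀ {n B} → Γ ∋ n ⦂ B → Red B (σ n)

•-RedSubst : RedSubst Γ σ → Red A a → RedSubst (A ∷ Γ) (a • σ)
•-RedSubst h ra here      = ra
•-RedSubst h ra (there x) = h x

adequacy : Γ ⊢ t ⦂ A → RedSubst Γ σ → Red A (subst σ t)
adequacy-body : (A ∷ Γ) ⊢ u ⦂ C → RedSubst Γ σ → RedBody A C (subst (exts σ) u)
adequacy-body₂ : (B ∷ A ∷ Γ) ⊢ u ⦂ C → RedSubst Γ σ → RedBody₂ A B C (subst (exts (exts σ)) u)

adequacy (⊢var x) h           = h x
adequacy {A = A} (⊢par d e) h = ∥-Red A (adequacy d h) (adequacy e h)
adequacy ⊢star h              = star-Red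
adequacy (⊢δ⊥ d) h            = δ⊥-Red (Hereditary⇒SN (adequacy d h))
adequacy (⊢lam d) h           = lam-Red (adequacy-body d h)
adequacy (⊢app d e) h         = app-Red (adequacy d h) (adequacy e h)
adequacy (⊢pair d e) h        = pair-Red (adequacy d h) (adequacy e h)
adequacy (⊢δ∧ d e) h          = δ∧-Red (adequacy d h) (adequacy-body₂ e h)
adequacy (⊢inl d) h           = inl-Red (adequacy d h)
adequacy (⊢inr d) h           = inr-Red (adequacy d h)
adequacy (⊢δ∨ d e f) h        = δ∨-Red (adequacy d h) (adequacy-body e h) (adequacy-body f h)
adequacy (⊢plus d e) h        = plus-Red (adequacy d h) (adequacy e h)
adequacy (⊢δ⊙ d e f) h        = δ⊙-Red (adequacy d h) (adequacy-body e h) (adequacy-body f h)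
adequacy (⊢δ⊙∥ d e f) h       = δ⊙∥-Red (adequacy d h) (adequacy-body e h) (adequacy-body f h)

adequacy-body {u = u} {C = C} {σ = σ} d h a ra =
  transport (Red C) (sym ([]-exts σ a u)) (adequacy d (•-RedSubst h ra))

adequacy-body₂ {u = u} {C = C} {σ = σ} d h a b ra rb =
  transport (Red C) (sym ([,]-exts σ a b u)) (adequacy d (•-RedSubst (•-RedSubst h ra) rb))

typed⇒Red : Γ ⊢ t ⦂ A → Red A t
typed⇒Red {t = t} {A} d =
  transport (Red A) (subst-var (λ _ → refl) t) (adequacy d λ {n} {B} _ → var-Red B n)

mainTheorem1 : ∀ (Γ : Ctx) (t : Term) (A : Form) → Γ ⊢ t ⦂ A → ¬ InfiniteReduction t
mainTheorem1 Γ t A d = SN⇒¬InfiniteReduction (Hereditary⇒SN (typed⇒Red d))
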